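{- Let $D$ be a digraph, $X\subseteq V(D)$, and $M$ the adjacency matrix of $D$ over $\mathbb{GF}(2)$. If $\operatorname{rk}(M[V(D)\setminus X,X])\leq k$, then there exist a set $S$ with $|S|\leq 1+2^k$ and functions $\lambda_1:V(D)\setminus X\to S$, $\lambda_2:X\to S$ such that $(V(D)\setminus X,X)$ is $(\lambda_1,\lambda_2)$-consistent.
   Context: All digraphs are finite; $\vec{xy}$ denotes the directed edge from $x$ to $y$. $M$ has rows and columns indexed by $V(D)$, with entry $(u,v)$ equal to $1$ iff $\vec{uv}\in E(D)$, and $M[A,B]$ is the submatrix with rows indexed by $A$ and columns by $B$. Consistency: for a partition $(A,B)$ of $V(D)$ and functions $\lambda_A:A\to S$, $\lambda_B:B\to S$, the partition $(A,B)$ is $(\lambda_A,\lambda_B)$-consistent if both of the following hold: (i) whenever $a_1,a_2\in A$ satisfy $\lambda_A(a_1)=\lambda_A(a_2)$ and $b\in B$, we have $\vec{a_1b}\in E(D)\iff\vec{a_2b}\in E(D)$; (ii) whenever $b_1,b_2\in B$ satisfy $\lambda_B(b_1)=\lambda_B(b_2)$ and $a\in A$, we have $\vec{ab_1}\in E(D)\iff\vec{ab_2}\in E(D)$. -}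

module Defs where

open import Data.Nat using (ℕ; zero; suc)
open import Data.Fin using (Fin)
import Data.Fin
open import Data.Bool using (Bool; true; false; _xor_; _∧_)
open import Data.Product using (Σ; ∃; _×_; _,_)
open import Relation.Binary.PropositionalEquality using (_≡_)
open import Function.Bundles using (_⇔_)

-- A digraph on vertex set Fin n, given by its adjacency relation as a
-- Bool-valued function: E u v ≡ true  iff  uv is a directed edge.
-- (This is exactly the adjacency matrix M over GF(2) = Bool.)
record Digraph (n : ℕ) : Set where
  field
    E : Fin n → Fin n → Bool
open Digraph public

M : ∀ {n} → Digraph n → Fin n → Fin n → Bool
M D = E D

VSet : ℕ → Set
VSet n = Fin n → Bool

Outside : ∀ {n} → VSet n → Set
Outside {n} X = Σ (Fin n) (λ v → X v ≡ false)

Inside : ∀ {n} → VSet n → Set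
Inside {n} X = Σ (Fin n) (λ v → X v ≡ true)

gfSum : ∀ {k} → (Fin k → Bool) → Bool
gfSum {zero} f = false
gfSum {suc k} f = f Data.Fin.zero xor gfSum {k} (λ i → f (Data.Fin.suc i))


linComb : ∀ {k} {C : Set} → (Fin k → Bool) → (Fin k → C → Bool) → C → Bool
linComb c w j = gfSum (λ i → c i ∧ w i j)

-- rk(A) ≤ k over GF(2) for a matrix A with rows R and columns C:
-- the row space of A has dimension ≤ k, i.e. is spanned by k vectors
-- of GF(2)^C.
RankAtMost : {R C : Set} → (R → C → Bool) → ℕ → Set
RankAtMost {R} {C} A k =
  Σ (Fin k → C → Bool) λ w →
    (r : R) → Σ (Fin k → Bool) λ c → (j : C) → A r j ≡ linComb c w j

subMatrix : ∀ {n} (D : Digraph n) (X : VSet n) → Outside X → Inside X → Bool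
subMatrix D X (u , _) (v , _) = M D u v

Consistent : ∀ {n} (D : Digraph n) (X : VSet n) {S : Set}
  → (Outside X → S) → (Inside X → S) → Set
Consistent D X λA λB =
  ((a₁ a₂ : Outside X) → λA a₁ ≡ λA a₂ → (b : Inside X) →
     (subMatrix D X a₁ b ≡ true) ⇔ (subMatrix D X a₂ b ≡ true))
  × ((b₁ b₂ : Inside X) → λB b₁ ≡ λB b₂ → (a : Outside X) →
     (subMatrix D X a b₁ ≡ true) ⇔ (subMatrix D X a b₂ ≡ true))

-- A GF(2) matrix of rank at most k has all its rows in the span of k fixed
-- vectors w₁ … w_k.  Row r is then determined by its coefficient vector
-- c ∈ GF(2)^k, and the entry Σ cᵢ wᵢ(j) depends on column j only through
-- (w₁(j), …, w_k(j)) ∈ GF(2)^k.  Labelling rows by their coefficients and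
-- columns by these projections, both read as numbers below 2^k, gives
-- consistent labellings with 2^k ≤ 1 + 2^k labels.
module Submission where

open import Defs
open import Data.Nat using (ℕ; zero; suc; _≤_; _+_; _^_)
open import Data.Nat.Properties using (n≤1+n)
open import Data.Fin using (Fin; funToFin; finToFun)
open import Data.Fin.Properties using (2↔Bool; finToFun-funToFin)
open import Data.Product using (Σ; _×_; _,_; proj₁; proj₂)
open import Data.Bool using (Bool; true; _xor_; _∧_)
open import Function using (_∘_; id)
open import Function.Bundles using (_⇔_; mk⇔; Inverse)
open import Relation.Binary.PropositionalEquality
  using (_≡_; refl; sym; trans; cong; cong₂; module ≡-Reasoning)

gfSum-cong : ∀ {k} {f g : Fin k → Bool} → (∀ i → f i ≡ g i) → gfSum f ≡ gfSum g
gfSum-cong {k = zero}  f≗g = refl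
gfSum-cong {k = suc k} f≗g = cong₂ _xor_ (f≗g Fin.zero) (gfSum-cong (f≗g ∘ Fin.suc))

linComb-congˡ : ∀ {k} {C : Set} {c c′ : Fin k → Bool} (w : Fin k → C → Bool) →
                (∀ i → c i ≡ c′ i) → ∀ j → linComb c w j ≡ linComb c′ w j
linComb-congˡ w c≗c′ j = gfSum-cong (λ i → cong (_∧ w i j) (c≗c′ i))

linComb-congʳ : ∀ {k} {C : Set} (c : Fin k → Bool) (w : Fin k → C → Bool) {j j′ : C} →
                (∀ i → w i j ≡ w i j′) → linComb c w j ≡ linComb c w j′
linComb-congʳ c w wj≗wj′ = gfSum-cong (λ i → cong (c i ∧_) (wj≗wj′ i))

encodeBits : ∀ {k} → (Fin k → Bool) → Fin (2 ^ k)
encodeBits f = funToFin (Inverse.from 2↔Bool ∘ f)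

encodeBits-injective : ∀ {k} (f g : Fin k → Bool) → encodeBits f ≡ encodeBits g → ∀ i → f i ≡ g i
encodeBits-injective f g f≡g i = begin
  f i                                  ≡⟨ sym (decode-encode f) ⟩
  to (finToFun (encodeBits f) i)       ≡⟨ cong (λ x → to (finToFun x i)) f≡g ⟩
  to (finToFun (encodeBits g) i)       ≡⟨ decode-encode g ⟩
  g i                                  ∎
  where
  open ≡-Reasoning
  open Inverse 2↔Bool using (to; from; strictlyInverseˡ)

  decode-encode : ∀ h → to (finToFun (encodeBits h) i) ≡ h i
  decode-encode h = trans (cong to (finToFun-funToFin (from ∘ h) i)) (strictlyInverseˡ (h i))

SameRows : {R C : Set} → (R → C → Bool) → R → R → Set
SameRows A r r′ = ∀ j → A r j ≡ A r′ j

SameColumns : {R C : Set} → (R → C → Bool) → C → C → Set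
SameColumns A j j′ = ∀ r → A r j ≡ A r j′

rankAtMost⇒labelling : {R C : Set} {A : R → C → Bool} {k : ℕ} → RankAtMost A k →
  Σ (R → Fin (2 ^ k)) λ ρ → Σ (C → Fin (2 ^ k)) λ κ →
    (∀ r r′ → ρ r ≡ ρ r′ → SameRows A r r′) ×
    (∀ j j′ → κ j ≡ κ j′ → SameColumns A j j′)
rankAtMost⇒labelling {R} {C} {A} {k} (w , span) =
  encodeBits ∘ coefficients , encodeBits ∘ projection , sameRows , sameColumns
  where
  coefficients : R → Fin k → Bool
  coefficients r = proj₁ (span r)

  projection : C → Fin k → Bool
  projection j i = w i j

  sameRows : ∀ r r′ → encodeBits (coefficients r) ≡ encodeBits (coefficients r′) → SameRows A r r′
  sameRows r r′ e j = begin
    A r j                           ≡⟨ proj₂ (span r) j ⟩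
    linComb (coefficients r) w j    ≡⟨ linComb-congˡ w (encodeBits-injective _ _ e) j ⟩
    linComb (coefficients r′) w j   ≡⟨ sym (proj₂ (span r′) j) ⟩
    A r′ j                          ∎
    where open ≡-Reasoning

  sameColumns : ∀ j j′ → encodeBits (projection j) ≡ encodeBits (projection j′) → SameColumns A j j′
  sameColumns j j′ e r = begin
    A r j                           ≡⟨ proj₂ (span r) j ⟩
    linComb (coefficients r) w j    ≡⟨ linComb-congʳ (coefficients r) w (encodeBits-injective _ _ e) ⟩
    linComb (coefficients r) w j′   ≡⟨ sym (proj₂ (span r) j′) ⟩
    A r j′                          ∎
    where open ≡-Reasoning

≡⇒≡true⇔≡true : ∀ {a b : Bool} → a ≡ b → (a ≡ true) ⇔ (b ≡ true)
≡⇒≡true⇔≡true refl = mk⇔ id id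

mainTheorem12 : ∀ {n} (D : Digraph n) (X : VSet n) (k : ℕ)
    → RankAtMost (subMatrix D X) k
    → Σ ℕ λ m → (m ≤ 1 + 2 ^ k) × Σ (Outside X → Fin m) λ λ₁ → Σ (Inside X → Fin m) λ λ₂ → Consistent D X λ₁ λ₂
mainTheorem12 D X k rank
  with ρ , κ , sameRows , sameColumns ← rankAtMost⇒labelling rank =
  2 ^ k , n≤1+n _ , ρ , κ ,
  (λ a₁ a₂ e b → ≡⇒≡true⇔≡true (sameRows a₁ a₂ e b)) ,
  (λ b₁ b₂ e a → ≡⇒≡true⇔≡true (sameColumns b₁ b₂ e a))
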